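{- For every integer $n\ge 6$ there exist an $((n-3)\times n,\ n)$-near triple array and an $((n-3)\times(n-1),\ n)$-near triple array.
   Context: An $r\times c$ row-column design on $v$ symbols is an $r\times c$ array each of whose cells is filled with one of $v$ symbols. It is binary if no symbol occurs more than once in any row or in any column. Let $e=rc/v$, $e^-=\lfloor e\rfloor$, $e^+=\lceil e\rceil$. The design is equireplicate if $e$ is an integer and every symbol occurs exactly $e$ times, and near equireplicate if $e$ is not an integer and every symbol occurs $e^-$ or $e^+$ times. For a binary design, let $R_i$, $C_j$ be the symbol sets of row $i$ and column $j$, and put $\lambda_{rc}=\frac{1}{rc}\sum_{i,j}|R_i\cap C_j|$, $\lambda_{rr}=\binom{r}{2}^{ -1}\sum_{i<j}|R_i\cap R_j|$, $\lambda_{cc}=\binom{c}{2}^{ -1}\sum_{i<j}|C_i\cap C_j|$; for real $x$, $x^-=\lfloor x\rfloor$, $x^+=\lceil x\rceil$. An $(r\times c,v)$-near triple array is a binary $r\times c$ row-column design on $v$ symbols which is equireplicate or near equireplicate and in which every row and column share $\lambda_{rc}^-$ or $\lambda_{rc}^+$ symbols, every two distinct rows share $\lambda_{rr}^-$ or $\lambda_{rr}^+$ symbols, and every two distinct columns share $\lambda_{cc}^-$ or $\lambda_{cc}^+$ symbols. -}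

module Defs where

open import Data.Nat using (ℕ; zero; suc; _+_; _*_; _∸_; _≤_; _<ᵇ_)
open import Data.Nat.DivMod using (_/_)
open import Data.Nat.Combinatorics using (_C_)
open import Data.Bool using (Bool; true; false; if_then_else_; _∧_; _∨_)
open import Data.Fin using (Fin; zero; suc; toℕ; _≟_)
open import Data.Product using (Σ; _×_)
open import Data.Sum using (_⊎_)
open import Relation.Nullary.Decidable using (does)
open import Relation.Nullary using (¬_)
open import Relation.Binary.PropositionalEquality using (_≡_)

Design : ℕ → ℕ → ℕ → Set
Design r c v = Fin r → Fin c → Fin v

sumF : ∀ {n} → (Fin n → ℕ) → ℕ
sumF {zero} f = 0
sumF {suc n} f = f zero + sumF (λ i → f (suc i))

count : ∀ {n} → (Fin n → Bool) → ℕ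
count p = sumF (λ i → if p i then 1 else 0)

anyF : ∀ {n} → (Fin n → Bool) → Bool
anyF {zero} p = false
anyF {suc n} p = p zero ∨ anyF (λ i → p (suc i))

sumPairs : ∀ {n} → (Fin n → Fin n → ℕ) → ℕ
sumPairs f = sumF (λ i → sumF (λ j → if toℕ i <ᵇ toℕ j then f i j else 0))

-- floor and ceiling of the fraction a / b (b = 0 never used meaningfully; set to 0)
floorDiv : ℕ → ℕ → ℕ
floorDiv a zero = 0
floorDiv a (suc b) = a / suc b

ceilDiv : ℕ → ℕ → ℕ
ceilDiv a zero = 0
ceilDiv a (suc b) = (a + b) / suc b

FloorOrCeil : ℕ → ℕ → ℕ → Set
FloorOrCeil x a b = (x ≡ floorDiv a b) ⊎ (x ≡ ceilDiv a b)

module _ {r c v : ℕ} (A : Design r c v) where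

  Binary : Set
  Binary = (∀ i j j' → A i j ≡ A i j' → j ≡ j')
         × (∀ j i i' → A i j ≡ A i' j → i ≡ i')

  replication : Fin v → ℕ
  replication s = sumF (λ i → count (λ j → does (A i j ≟ s)))

  -- equireplicate (e integer: e⁻ = e⁺ = e) or near equireplicate
  EquiOrNearEquireplicate : Set
  EquiOrNearEquireplicate = ∀ s → FloorOrCeil (replication s) (r * c) v

  rowHas : Fin r → Fin v → Bool
  rowHas i s = anyF (λ j → does (A i j ≟ s))

  colHas : Fin c → Fin v → Bool
  colHas j s = anyF (λ i → does (A i j ≟ s))

  rcMeet : Fin r → Fin c → ℕ
  rcMeet i j = count (λ s → rowHas i s ∧ colHas j s)

  rrMeet : Fin r → Fin r → ℕ
  rrMeet i i' = count (λ s → rowHas i s ∧ rowHas i' s)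

  ccMeet : Fin c → Fin c → ℕ
  ccMeet j j' = count (λ s → colHas j s ∧ colHas j' s)

  IsNearTripleArray : Set
  IsNearTripleArray =
      Binary
    × EquiOrNearEquireplicate
    × (∀ i j → FloorOrCeil (rcMeet i j) (sumF (λ i → sumF (λ j → rcMeet i j))) (r * c))
    × (∀ i i' → ¬ (i ≡ i') → FloorOrCeil (rrMeet i i') (sumPairs rrMeet) (r C 2))
    × (∀ j j' → ¬ (j ≡ j') → FloorOrCeil (ccMeet j j') (sumPairs ccMeet) (c C 2))

NearTripleArray : ℕ → ℕ → ℕ → Set
NearTripleArray r c v = Σ (Design r c v) IsNearTripleArray

-- Let D = {0, 1, 3} ⊆ ℤ/n and index the rows of A by the ρ ∉ D, with A(ρ, j) = ρ + j.
-- Every row of A is all of ℤ/n and column j misses exactly D + j; deleting column 0 gives A⁻,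
-- whose row ρ misses only ρ. By inclusion–exclusion every row/column, row/row and column/column
-- intersection has size n minus the sizes of two missing sets plus the size of their intersection.
-- The missing sets are singletons or translates of D, and D is a Sidon set, so for n ≥ 7 two
-- distinct translates share at most one point (for n = 6 the column meets are computed). Thus each
-- family of intersection sizes and replication numbers takes two consecutive values a and a + 1,
-- and such a family consists of floors and ceilings of its average.

module Submission where

open import Defs
open import Data.Nat using (ℕ; _≤_; _∸_)
open import Data.Product using (_×_)

open import Data.Bool using (Bool; true; false; not; _∧_; _∨_; if_then_else_)
open import Data.Bool.Properties using (∧-comm; ∧-identityʳ; ∧-conicalˡ; ∧-conicalʳ; ¬-not; T-≡)
open import Data.Empty using (⊥-elim)
open import Data.Fin using (Fin; zero; suc; toℕ; fromℕ<; _≟_)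
open import Data.Fin.Properties using (toℕ-injective; suc-injective; toℕ<n; toℕ-fromℕ<; fromℕ<-injective; all?)
open import Data.Nat using () renaming (_≟_ to _≟ℕ_)
open import Data.Nat using (suc; _+_; _*_; _<_; _<ᵇ_; z≤n; s≤s; s≤s⁻¹; NonZero)
open import Data.Nat.Properties hiding (_≟_; suc-injective)
open import Data.Nat.Tactic.RingSolver using (solve-∀)
open import Data.Nat.DivMod using (_/_; _%_; _mod_; m*n/n≡m; /-monoˡ-≤; m<n*o⇒m/o<n; m%n<n; m%n%n≡m%n; %-distribˡ-+; [m+n]%n≡m%n; m<n⇒m%n≡m)
open import Data.Nat.Combinatorics using (_C_; nC1≡n; nCk+nC[k+1]≡[n+1]C[k+1])
open import Data.Product using (∃; _,_; proj₁; proj₂)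
open import Data.Sum using (_⊎_; inj₁; inj₂; reduce)
open import Function using (_∘_; case_of_; mk⇔; Equivalence)
open import Function.Definitions using (Injective)
open import Relation.Binary using (Tri; tri<; tri≈; tri>)
open import Relation.Nullary using (Dec)
open import Relation.Nullary.Decidable using (does; yes; no; dec-true; dec-false; does-⇔; toWitness; ¬?; _→-dec_; _×-dec_; _⊎-dec_)
open import Relation.Binary.PropositionalEquality
open import Algebra.Properties.CommutativeSemigroup +-commutativeSemigroup using (interchange)

infix 4 _∈⟦_,_⟧
_∈⟦_,_⟧ : ℕ → ℕ → ℕ → Set
x ∈⟦ a , b ⟧ = a ≤ x × x ≤ b

sumF-cong : ∀ {n} {f g : Fin n → ℕ} → (∀ i → f i ≡ g i) → sumF f ≡ sumF g
sumF-cong {ℕ.zero} f≗g = refl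
sumF-cong {suc n}  f≗g = cong₂ _+_ (f≗g zero) (sumF-cong (f≗g ∘ suc))

sumF-+ : ∀ {n} (f g : Fin n → ℕ) → sumF (λ i → f i + g i) ≡ sumF f + sumF g
sumF-+ {ℕ.zero} f g = refl
sumF-+ {suc n}  f g = trans (cong (f zero + g zero +_) (sumF-+ (f ∘ suc) (g ∘ suc)))
                            (interchange (f zero) (g zero) (sumF (f ∘ suc)) (sumF (g ∘ suc)))

sumF-const : ∀ {n} a → sumF {n} (λ _ → a) ≡ n * a
sumF-const {ℕ.zero} a = refl
sumF-const {suc n}  a = cong (a +_) (sumF-const {n} a)

sumF-*ʳ : ∀ {n} (f : Fin n → ℕ) a → sumF (λ i → f i * a) ≡ sumF f * a
sumF-*ʳ {ℕ.zero} f a = refl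
sumF-*ʳ {suc n}  f a = trans (cong (f zero * a +_) (sumF-*ʳ (f ∘ suc) a))
                             (sym (*-distribʳ-+ a (f zero) (sumF (f ∘ suc))))

sumF-mono-≤ : ∀ {n} {f g : Fin n → ℕ} → (∀ i → f i ≤ g i) → sumF f ≤ sumF g
sumF-mono-≤ {ℕ.zero} f≤g = z≤n
sumF-mono-≤ {suc n}  f≤g = +-mono-≤ (f≤g zero) (sumF-mono-≤ (f≤g ∘ suc))

sumF-mono-< : ∀ {n} {f g : Fin n → ℕ} → (∀ i → f i ≤ g i) → ∀ k → f k < g k → sumF f < sumF g
sumF-mono-< f≤g zero    fk<gk = +-mono-<-≤ fk<gk (sumF-mono-≤ (f≤g ∘ suc))
sumF-mono-< f≤g (suc k) fk<gk = +-mono-≤-< (f≤g zero) (sumF-mono-< (f≤g ∘ suc) k fk<gk)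

count-cong : ∀ {n} {p q : Fin n → Bool} → (∀ i → p i ≡ q i) → count p ≡ count q
count-cong p≗q = sumF-cong (λ i → cong (λ b → if b then 1 else 0) (p≗q i))

count-false : ∀ {n} → count {n} (λ _ → false) ≡ 0
count-false {n} = trans (sumF-const {n} 0) (*-zeroʳ n)

count-true : ∀ {n} → count {n} (λ _ → true) ≡ n
count-true {n} = trans (sumF-const {n} 1) (*-identityʳ n)

count-all-false : ∀ {n} {p : Fin n → Bool} → (∀ i → p i ≡ false) → count p ≡ 0
count-all-false {n} p≡false = trans (count-cong p≡false) (count-false {n})

count-∨ : ∀ {n} (p q : Fin n → Bool) → (∀ i → p i ≡ true → q i ≡ false) →
          count (λ i → p i ∨ q i) ≡ count p + count q
count-∨ p q disjoint = trans (sumF-cong (λ i → pointwise (p i) (q i) (disjoint i)))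
                             (sumF-+ (λ i → if p i then 1 else 0) (λ i → if q i then 1 else 0))
  where
  pointwise : ∀ a b → (a ≡ true → b ≡ false) →
              (if a ∨ b then 1 else 0) ≡ (if a then 1 else 0) + (if b then 1 else 0)
  pointwise true  b     a⇒¬b rewrite a⇒¬b refl = refl
  pointwise false true  _ = refl
  pointwise false false _ = refl

count-not : ∀ {n} (p : Fin n → Bool) → count (λ i → not (p i)) + count p ≡ n
count-not {n} p = trans (sym (sumF-+ (λ i → if not (p i) then 1 else 0) (λ i → if p i then 1 else 0)))
                        (trans (sumF-cong (λ i → pointwise (p i))) (count-true {n}))
  where
  pointwise : ∀ a → (if not a then 1 else 0) + (if a then 1 else 0) ≡ 1
  pointwise true  = refl
  pointwise false = refl

count-not-∧-not : ∀ {n} (p q : Fin n → Bool) →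
  count (λ i → not (p i) ∧ not (q i)) + (count p + count q) ≡ n + count (λ i → p i ∧ q i)
count-not-∧-not {n} p q = begin
  count (λ i → not (p i) ∧ not (q i)) + (count p + count q)
    ≡⟨ cong (count (λ i → not (p i) ∧ not (q i)) +_) (sym (sumF-+ (ind ∘ p) (ind ∘ q))) ⟩
  count (λ i → not (p i) ∧ not (q i)) + sumF (λ i → ind (p i) + ind (q i))
    ≡⟨ sym (sumF-+ (λ i → ind (not (p i) ∧ not (q i))) _) ⟩
  sumF (λ i → ind (not (p i) ∧ not (q i)) + (ind (p i) + ind (q i)))
    ≡⟨ sumF-cong (λ i → pointwise (p i) (q i)) ⟩
  sumF (λ i → 1 + ind (p i ∧ q i))
    ≡⟨ sumF-+ (λ _ → 1) (λ i → ind (p i ∧ q i)) ⟩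
  count {n} (λ _ → true) + count (λ i → p i ∧ q i)
    ≡⟨ cong (_+ count (λ i → p i ∧ q i)) count-true ⟩
  n + count (λ i → p i ∧ q i) ∎
  where
  open ≡-Reasoning
  ind : Bool → ℕ
  ind b = if b then 1 else 0
  pointwise : ∀ a b → ind (not a ∧ not b) + (ind a + ind b) ≡ 1 + ind (a ∧ b)
  pointwise true  true  = refl
  pointwise true  false = refl
  pointwise false true  = refl
  pointwise false false = refl

count-∧-≤ˡ : ∀ {n} (p q : Fin n → Bool) → count (λ i → p i ∧ q i) ≤ count p
count-∧-≤ˡ p q = sumF-mono-≤ λ i → pointwise (p i) (q i)
  where
  pointwise : ∀ a b → (if a ∧ b then 1 else 0) ≤ (if a then 1 else 0)
  pointwise true  true  = ≤-refl
  pointwise true  false = z≤n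
  pointwise false _     = z≤n

count-not-∈ : ∀ {n} (p : Fin (suc n) → Bool) → count p ≤ 1 → count (λ i → not (p i)) ∈⟦ n , suc n ⟧
count-not-∈ {n} p count≤1 = s≤s⁻¹ (begin
    suc n             ≡⟨ count-not p ⟨
    X + count p       ≤⟨ +-monoʳ-≤ X count≤1 ⟩
    X + 1             ≡⟨ +-comm X 1 ⟩
    suc X             ∎)
  , m+n≤o⇒m≤o X (≤-reflexive (count-not p))
  where
  open ≤-Reasoning
  X = count (λ i → not (p i))

count-∧-of-complements : ∀ {n} {p q p′ q′ : Fin n → Bool} a →
  (∀ i → p′ i ≡ not (p i)) → (∀ i → q′ i ≡ not (q i)) →
  count p + count q + a ≡ n → count (λ i → p i ∧ q i) ≤ 1 → count (λ i → p′ i ∧ q′ i) ∈⟦ a , suc a ⟧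
count-∧-of-complements {n} {p} {q} {p′} {q′} a p′≡ q′≡ sizes meet≤1 =
  subst (_∈⟦ a , suc a ⟧) (sym X≡) (m≤m+n a t , subst (a + t ≤_) (+-comm a 1) (+-monoʳ-≤ a meet≤1))
  where
  open ≡-Reasoning
  k = count p + count q
  t = count (λ i → p i ∧ q i)
  X = count (λ i → not (p i) ∧ not (q i))
  X≡ : count (λ i → p′ i ∧ q′ i) ≡ a + t
  X≡ = trans (count-cong λ i → cong₂ _∧_ (p′≡ i) (q′≡ i)) (+-cancelʳ-≡ k X (a + t) (begin
    X + k       ≡⟨ count-not-∧-not p q ⟩
    n + t       ≡⟨ cong (_+ t) sizes ⟨
    k + a + t   ≡⟨ +-assoc k a t ⟩
    k + (a + t) ≡⟨ +-comm k (a + t) ⟩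
    a + t + k   ∎))

does-true⇒ : ∀ {A : Set} (a? : Dec A) → does a? ≡ true → A
does-true⇒ (yes a) _ = a

count-≟ : ∀ {n} (t : Fin n) → count (λ s → does (t ≟ s)) ≡ 1
count-≟ {suc n} zero    = cong suc (count-false {n})
count-≟ {suc n} (suc t) = count-≟ t

count-≤1 : ∀ {n} (p : Fin n → Bool) → (∀ i j → p i ≡ true → p j ≡ true → i ≡ j) → count p ≤ 1
count-≤1 {ℕ.zero} p unique = z≤n
count-≤1 {suc n}  p unique with p zero in p0
... | true  = ≤-reflexive (cong suc (count-all-false others))
  where
  others : ∀ i → p (suc i) ≡ false
  others i = ¬-not λ psi → case (unique zero (suc i) p0 psi) of λ ()
... | false = count-≤1 (p ∘ suc) (λ i j pi pj → suc-injective (unique (suc i) (suc j) pi pj))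

inImage : ∀ {k n} → (Fin k → Fin n) → Fin n → Bool
inImage g s = anyF (λ x → does (g x ≟ s))

inImage-intro : ∀ {k n} (g : Fin k → Fin n) {s} x → g x ≡ s → inImage g s ≡ true
inImage-intro g {s} zero    g0≡s rewrite dec-true (g zero ≟ s) g0≡s = refl
inImage-intro g {s} (suc x) gx≡s with does (g zero ≟ s)
... | true  = refl
... | false = inImage-intro (g ∘ suc) x gx≡s

inImage-elim : ∀ {k n} (g : Fin k → Fin n) {s} → inImage g s ≡ true → ∃ λ x → g x ≡ s
inImage-elim {suc k} g {s} e with g zero ≟ s
... | yes g0≡s = zero , g0≡s
... | no  _    = let x , gx≡s = inImage-elim (g ∘ suc) e in suc x , gx≡s

inImage-false : ∀ {k n} (g : Fin k → Fin n) {s} → (∀ x → g x ≢ s) → inImage g s ≡ false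
inImage-false g g≢s = ¬-not λ e → let x , gx≡s = inImage-elim g e in g≢s x gx≡s

count-inImage : ∀ {k n} (g : Fin k → Fin n) → Injective _≡_ _≡_ g → count (inImage g) ≡ k
count-inImage {ℕ.zero} {n} g _ = count-false {n}
count-inImage {suc k}      g inj =
  trans (count-∨ (λ s → does (g zero ≟ s)) (inImage (g ∘ suc)) disjoint)
        (cong₂ _+_ (count-≟ (g zero)) (count-inImage (g ∘ suc) (suc-injective ∘ inj)))
  where
  disjoint : ∀ s → does (g zero ≟ s) ≡ true → inImage (g ∘ suc) s ≡ false
  disjoint s g0≡s = inImage-false (g ∘ suc) λ x gx≡s →
    case inj (trans gx≡s (sym (does-true⇒ (g zero ≟ s) g0≡s))) of λ ()

count-fiber : ∀ {k n} (g : Fin k → Fin n) → Injective _≡_ _≡_ g →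
              ∀ s → count (λ x → does (g x ≟ s)) ≡ (if inImage g s then 1 else 0)
count-fiber g inj s with inImage g s in e
... | true  = let x₀ , gx₀≡s = inImage-elim g e in
  trans (count-cong λ x → does-⇔ (mk⇔ (λ gx≡s → inj (trans gx₀≡s (sym gx≡s))) λ { refl → gx₀≡s })
                                 (g x ≟ s) (x₀ ≟ x))
        (count-≟ x₀)
... | false = count-all-false λ x → dec-false (g x ≟ s) λ gx≡s →
  case trans (sym e) (inImage-intro g x gx≡s) of λ ()

-- Families taking two consecutive values

floorDiv-unique : ∀ {S N q} → N * q ≤ S → S < N * suc q → floorDiv S N ≡ q
floorDiv-unique {S} {N@(suc _)} {q} lo hi = ≤-antisym
  (s≤s⁻¹ (m<n*o⇒m/o<n (subst (S <_) (*-comm N (suc q)) hi)))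
  (subst (_≤ S / N) (m*n/n≡m q N) (/-monoˡ-≤ N (subst (_≤ S) (*-comm N q) lo)))

ceilDiv-unique : ∀ {S N q} → N * q < S → S ≤ N * suc q → ceilDiv S N ≡ suc q
ceilDiv-unique {N = ℕ.zero} lo hi = ⊥-elim (<⇒≱ lo hi)
ceilDiv-unique {S} {N@(suc k)} {q} lo hi = floorDiv-unique {S + k} {N} lo′ hi′
  where
  open ≤-Reasoning
  lo′ : N * suc q ≤ S + k
  lo′ = begin
    N * suc q       ≡⟨ *-suc N q ⟩
    suc (k + N * q) ≡⟨ cong suc (+-comm k (N * q)) ⟩
    suc (N * q) + k ≤⟨ +-monoˡ-≤ k lo ⟩
    S + k           ∎
  hi′ : S + k < N * suc (suc q)
  hi′ = begin-strict
    S + k         <⟨ +-mono-≤-< hi (n<1+n k) ⟩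
    N * suc q + N ≡⟨ +-comm (N * suc q) N ⟩
    N + N * suc q ≡⟨ *-suc N (suc q) ⟨
    N * suc (suc q) ∎

floorOrCeil-of-bounds : ∀ {x a S N} → N * a ≤ S → S ≤ N * suc a →
  (x < suc a → S < N * suc a) → (a < x → N * a < S) → x ∈⟦ a , suc a ⟧ → FloorOrCeil x S N
floorOrCeil-of-bounds {x} {a} {S} {N} lo hi strictHi strictLo (a≤x , x≤1+a) with m≤n⇒m<n∨m≡n a≤x
... | inj₂ refl = inj₁ (sym (floorDiv-unique {S} {N} lo (strictHi (n<1+n a))))
... | inj₁ a<x  = inj₂ (trans (≤-antisym x≤1+a a<x) (sym (ceilDiv-unique {S} {N} (strictLo a<x) hi)))

-- The plain double sum and sumPairs are definitionally sumWhere with P = λ _ _ → true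
-- and P = λ i j → toℕ i <ᵇ toℕ j.
sumWhere : ∀ {r c} → (Fin r → Fin c → Bool) → (Fin r → Fin c → ℕ) → ℕ
sumWhere P f = sumF (λ i → sumF (λ j → if P i j then f i j else 0))

module _ {r c} (P : Fin r → Fin c → Bool) where

  private
    masked-≤ : ∀ b {x y} → (b ≡ true → x ≤ y) → (if b then x else 0) ≤ (if b then y else 0)
    masked-≤ true  x≤y = x≤y refl
    masked-≤ false _   = z≤n

    masked-< : ∀ {b x y} → b ≡ true → x < y → (if b then x else 0) < (if b then y else 0)
    masked-< refl x<y = x<y

  sumWhere-const : ∀ a → sumWhere P (λ _ _ → a) ≡ sumWhere P (λ _ _ → 1) * a
  sumWhere-const a =
    trans (sumF-cong λ i → trans (sumF-cong λ j → pointwise (P i j)) (sumF-*ʳ (λ j → if P i j then 1 else 0) a))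
          (sumF-*ʳ (λ i → sumF (λ j → if P i j then 1 else 0)) a)
    where
    pointwise : ∀ b → (if b then a else 0) ≡ (if b then 1 else 0) * a
    pointwise true  = sym (+-identityʳ a)
    pointwise false = refl

  sumWhere-mono-≤ : ∀ {f g} → (∀ i j → P i j ≡ true → f i j ≤ g i j) → sumWhere P f ≤ sumWhere P g
  sumWhere-mono-≤ f≤g = sumF-mono-≤ λ i → sumF-mono-≤ λ j → masked-≤ (P i j) (f≤g i j)

  sumWhere-mono-< : ∀ {f g} → (∀ i j → P i j ≡ true → f i j ≤ g i j) →
                    ∀ i j → P i j ≡ true → f i j < g i j → sumWhere P f < sumWhere P g
  sumWhere-mono-< f≤g i j Pij fij<gij =
    sumF-mono-< (λ i → sumF-mono-≤ λ j → masked-≤ (P i j) (f≤g i j)) i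
      (sumF-mono-< (λ j → masked-≤ (P i j) (f≤g i j)) j (masked-< Pij fij<gij))

  sumWhere-floorOrCeil : ∀ f a → (∀ i j → P i j ≡ true → f i j ∈⟦ a , suc a ⟧) →
    ∀ i j → P i j ≡ true → FloorOrCeil (f i j) (sumWhere P f) (sumWhere P (λ _ _ → 1))
  sumWhere-floorOrCeil f a bounds i j Pij =
    floorOrCeil-of-bounds {f i j} {a} {S} {sumWhere P (λ _ _ → 1)} lo hi strictHi strictLo (bounds i j Pij)
    where
    S = sumWhere P f
    a≤f : ∀ i j → P i j ≡ true → a ≤ f i j
    a≤f i j = proj₁ ∘ bounds i j
    f≤1+a : ∀ i j → P i j ≡ true → f i j ≤ suc a
    f≤1+a i j = proj₂ ∘ bounds i j
    lo = subst (_≤ S) (sumWhere-const a) (sumWhere-mono-≤ a≤f)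
    hi = subst (S ≤_) (sumWhere-const (suc a)) (sumWhere-mono-≤ f≤1+a)
    strictHi = subst (S <_) (sumWhere-const (suc a)) ∘ sumWhere-mono-< f≤1+a i j Pij
    strictLo = subst (_< S) (sumWhere-const a) ∘ sumWhere-mono-< a≤f i j Pij

cellCount : ∀ r c → sumWhere {r} {c} (λ _ _ → true) (λ _ _ → 1) ≡ r * c
cellCount r c = trans (sumF-cong {r} λ _ → count-true {c}) (sumF-const {r} c)

pairCount : ∀ r → sumPairs {r} (λ _ _ → 1) ≡ r C 2
pairCount ℕ.zero = refl
pairCount (suc r) = begin
  sumPairs {suc r} (λ _ _ → 1) ≡⟨ cong (_+ sumPairs {r} (λ _ _ → 1)) (count-true {r}) ⟩
  r + sumPairs {r} (λ _ _ → 1) ≡⟨ cong₂ _+_ (sym (nC1≡n r)) (pairCount r) ⟩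
  r C 1 + r C 2               ≡⟨ nCk+nC[k+1]≡[n+1]C[k+1] r 1 ⟩
  suc r C 2                   ∎
  where open ≡-Reasoning

floorOrCeil-cells : ∀ {r c} (f : Fin r → Fin c → ℕ) {a} → (∀ i j → f i j ∈⟦ a , suc a ⟧) →
  ∀ i j → FloorOrCeil (f i j) (sumF (λ i → sumF (λ j → f i j))) (r * c)
floorOrCeil-cells {r} {c} f {a} bounds i j =
  subst (FloorOrCeil (f i j) _) (cellCount r c)
        (sumWhere-floorOrCeil (λ _ _ → true) f a (λ i j _ → bounds i j) i j refl)

floorOrCeil-pairs : ∀ {r} (f : Fin r → Fin r → ℕ) {a} → (∀ i j → f i j ≡ f j i) →
  (∀ i j → i ≢ j → f i j ∈⟦ a , suc a ⟧) → ∀ i j → i ≢ j → FloorOrCeil (f i j) (sumPairs f) (r C 2)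
floorOrCeil-pairs {r} f {a} f-sym bounds i j i≢j = byOrder (<-cmp (toℕ i) (toℕ j))
  where
  ordered : ∀ i j → toℕ i < toℕ j → FloorOrCeil (f i j) (sumPairs f) (r C 2)
  ordered i j i<j = subst (FloorOrCeil (f i j) (sumPairs f)) (pairCount r)
    (sumWhere-floorOrCeil (λ i j → toℕ i <ᵇ toℕ j) f a
      (λ i j i<ᵇj → bounds i j λ i≡j → <⇒≢ (<ᵇ⇒< _ _ (Equivalence.from T-≡ i<ᵇj)) (cong toℕ i≡j))
      i j (Equivalence.to T-≡ (<⇒<ᵇ i<j)))
  byOrder : Tri (toℕ i < toℕ j) (toℕ i ≡ toℕ j) (toℕ j < toℕ i) → FloorOrCeil (f i j) (sumPairs f) (r C 2)
  byOrder (tri< i<j _ _) = ordered i j i<j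
  byOrder (tri≈ _ i≡j _) = ⊥-elim (i≢j (toℕ-injective i≡j))
  byOrder (tri> _ _ j<i) = subst (λ x → FloorOrCeil x (sumPairs f) (r C 2)) (f-sym j i) (ordered j i j<i)

module _ {r c v} (A : Design r c v) where

  rrMeet-sym : ∀ i i′ → rrMeet A i i′ ≡ rrMeet A i′ i
  rrMeet-sym i i′ = count-cong λ s → ∧-comm (rowHas A i s) (rowHas A i′ s)

  ccMeet-sym : ∀ j j′ → ccMeet A j j′ ≡ ccMeet A j′ j
  ccMeet-sym j j′ = count-cong λ s → ∧-comm (colHas A j s) (colHas A j′ s)

  replication-of-binaryRows : (∀ i j j′ → A i j ≡ A i j′ → j ≡ j′) →
                              ∀ s → replication A s ≡ count (λ i → rowHas A i s)
  replication-of-binaryRows rowInj s = sumF-cong λ i → count-fiber (A i) (rowInj i _ _) s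

  isNearTripleArray : ∀ {a b e} → Binary A → EquiOrNearEquireplicate A →
    (∀ i j → rcMeet A i j ∈⟦ a , suc a ⟧) →
    (∀ i i′ → i ≢ i′ → rrMeet A i i′ ∈⟦ b , suc b ⟧) →
    (∀ j j′ → j ≢ j′ → ccMeet A j j′ ∈⟦ e , suc e ⟧) → IsNearTripleArray A
  isNearTripleArray binary equireplicate rc rr cc =
      binary
    , equireplicate
    , floorOrCeil-cells (rcMeet A) rc
    , floorOrCeil-pairs (rrMeet A) rrMeet-sym rr
    , floorOrCeil-pairs (ccMeet A) ccMeet-sym cc

dropFirstColumn : ∀ {r c v} → Design r (suc c) v → Design r c v
dropFirstColumn A i j = A i (suc j)

module _ {r c v} (A : Design r (suc c) v) (binary : Binary A) where

  dropFirstColumn-binary : Binary (dropFirstColumn A)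
  dropFirstColumn-binary = (λ i j j′ → suc-injective ∘ proj₁ binary i (suc j) (suc j′))
                         , (λ j → proj₂ binary (suc j))

  rowHas-dropFirstColumn : ∀ i s → rowHas (dropFirstColumn A) i s ≡ rowHas A i s ∧ not (does (A i zero ≟ s))
  rowHas-dropFirstColumn i s = split (does (A i zero ≟ s)) (rowHas (dropFirstColumn A) i s) exclusive
    where
    split : ∀ a b → (a ≡ true → b ≡ false) → b ≡ (a ∨ b) ∧ not a
    split true  b a⇒¬b = a⇒¬b refl
    split false b _    = sym (∧-identityʳ b)
    exclusive : does (A i zero ≟ s) ≡ true → rowHas (dropFirstColumn A) i s ≡ false
    exclusive Ai0≡s = inImage-false (dropFirstColumn A i) λ j Aij≡s →
      case proj₁ binary i zero (suc j) (trans (does-true⇒ (A i zero ≟ s) Ai0≡s) (sym Aij≡s)) of λ ()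

-- Cyclic shifts of ℤ/n

[m+n%d]%d≡[m+n]%d : ∀ m n d .{{_ : NonZero d}} → (m + n % d) % d ≡ (m + n) % d
[m+n%d]%d≡[m+n]%d m n d = begin
  (m + n % d) % d           ≡⟨ %-distribˡ-+ m (n % d) d ⟩
  (m % d + n % d % d) % d   ≡⟨ cong (λ k → (m % d + k) % d) (m%n%n≡m%n n d) ⟩
  (m % d + n % d) % d       ≡⟨ %-distribˡ-+ m n d ⟨
  (m + n) % d               ∎
  where open ≡-Reasoning

module CyclicShift (n : ℕ) .{{_ : NonZero n}} where

  shift : ℕ → Fin n → Fin n
  shift c j = (c + toℕ j) mod n

  unshift : ℕ → Fin n → Fin n
  unshift c = shift (n ∸ c)

  toℕ-shift : ∀ c j → toℕ (shift c j) ≡ (c + toℕ j) % n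
  toℕ-shift c j = toℕ-fromℕ< (m%n<n (c + toℕ j) n)

  shift-shift : ∀ a b j → shift a (shift b j) ≡ shift (a + b) j
  shift-shift a b j = toℕ-injective (begin
    toℕ (shift a (shift b j))  ≡⟨ toℕ-shift a (shift b j) ⟩
    (a + toℕ (shift b j)) % n  ≡⟨ cong (λ k → (a + k) % n) (toℕ-shift b j) ⟩
    (a + (b + toℕ j) % n) % n  ≡⟨ [m+n%d]%d≡[m+n]%d a (b + toℕ j) n ⟩
    (a + (b + toℕ j)) % n      ≡⟨ cong (_% n) (+-assoc a b (toℕ j)) ⟨
    (a + b + toℕ j) % n        ≡⟨ toℕ-shift (a + b) j ⟨
    toℕ (shift (a + b) j)      ∎)
    where open ≡-Reasoning

  shift-n : ∀ j → shift n j ≡ j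
  shift-n j = toℕ-injective (begin
    toℕ (shift n j)     ≡⟨ toℕ-shift n j ⟩
    (n + toℕ j) % n     ≡⟨ cong (_% n) (+-comm n (toℕ j)) ⟩
    (toℕ j + n) % n     ≡⟨ [m+n]%n≡m%n (toℕ j) n ⟩
    toℕ j % n           ≡⟨ m<n⇒m%n≡m (toℕ<n j) ⟩
    toℕ j               ∎)
    where open ≡-Reasoning

  shift-unshift : ∀ {c} → c ≤ n → ∀ s → shift c (unshift c s) ≡ s
  shift-unshift {c} c≤n s = trans (shift-shift c (n ∸ c) s)
                                  (trans (cong (λ k → shift k s) (m+[n∸m]≡n c≤n)) (shift-n s))

  unshift-shift : ∀ {c} → c ≤ n → ∀ j → unshift c (shift c j) ≡ j
  unshift-shift {c} c≤n j = trans (shift-shift (n ∸ c) c j)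
                                  (trans (cong (λ k → shift k j) (m∸n+n≡m c≤n)) (shift-n j))

  shift-injective : ∀ {c} → c ≤ n → Injective _≡_ _≡_ (shift c)
  shift-injective {c} c≤n {j} {j′} e =
    trans (sym (unshift-shift c≤n j)) (trans (cong (unshift c) e) (unshift-shift c≤n j′))

  shift-comm : ∀ t j → shift (toℕ t) j ≡ shift (toℕ j) t
  shift-comm t j = cong (_mod n) (+-comm (toℕ t) (toℕ j))

  shift-injectiveˡ : ∀ {a b} j → a < n → b < n → shift a j ≡ shift b j → a ≡ b
  shift-injectiveˡ {a} {b} j a<n b<n e = fromℕ<-injective a b a<n b<n
    (shift-injective (<⇒≤ (toℕ<n j)) (trans (as-shift-of j a<n) (trans e (sym (as-shift-of j b<n)))))
    where
    as-shift-of : ∀ {k} j (k<n : k < n) → shift (toℕ j) (fromℕ< k<n) ≡ shift k j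
    as-shift-of j k<n = trans (sym (shift-comm (fromℕ< k<n) j)) (cong (λ k → shift k j) (toℕ-fromℕ< k<n))

  shift-parallelogram : ∀ {a b a′ b′ j j′} → shift a j ≡ shift b j′ → shift a′ j ≡ shift b′ j′ →
                        shift (a + b′) j ≡ shift (a′ + b) j
  shift-parallelogram {a} {b} {a′} {b′} {j} {j′} e e′ = begin
    shift (a + b′) j          ≡⟨ cong (λ k → shift k j) (+-comm a b′) ⟩
    shift (b′ + a) j          ≡⟨ shift-shift b′ a j ⟨
    shift b′ (shift a j)      ≡⟨ cong (shift b′) e ⟩
    shift b′ (shift b j′)     ≡⟨ shift-shift b′ b j′ ⟩
    shift (b′ + b) j′         ≡⟨ cong (λ k → shift k j′) (+-comm b′ b) ⟩
    shift (b + b′) j′         ≡⟨ shift-shift b b′ j′ ⟨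
    shift b (shift b′ j′)     ≡⟨ cong (shift b) e′ ⟨
    shift b (shift a′ j)      ≡⟨ shift-shift b a′ j ⟩
    shift (b + a′) j          ≡⟨ cong (λ k → shift k j) (+-comm b a′) ⟩
    shift (a′ + b) j          ∎
    where open ≡-Reasoning

d : Fin 3 → ℕ
d zero             = 0
d (suc zero)       = 1
d (suc (suc zero)) = 3

d≤3 : ∀ x → d x ≤ 3
d≤3 zero             = z≤n
d≤3 (suc zero)       = s≤s z≤n
d≤3 (suc (suc zero)) = ≤-refl

d-sidon : ∀ x y x′ y′ → d x + d y′ ≡ d x′ + d y → x ≡ x′ ⊎ x ≡ y
d-sidon = toWitness {a? = all? λ x → all? λ y → all? λ x′ → all? λ y′ →
  (d x + d y′ ≟ℕ d x′ + d y) →-dec (x ≟ x′ ⊎-dec x ≟ y)} _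

d-injective : Injective _≡_ _≡_ d
d-injective {x} {y} dx≡dy = reduce (d-sidon x y y y (cong (_+ d y) dx≡dy))

module Construction (p : ℕ) where

  n : ℕ
  n = 6 + p

  open CyclicShift n

  d<n : ∀ x → d x < n
  d<n x = s≤s (≤-trans (d≤3 x) (m≤m+n 3 (2 + p)))

  -- ρ enumerates {0, …, n − 1} ∖ D.
  ρ : Fin (3 + p) → ℕ
  ρ zero    = 2
  ρ (suc i) = 4 + toℕ i

  ρ<n : ∀ i → ρ i < n
  ρ<n zero    = s≤s (s≤s (s≤s z≤n))
  ρ<n (suc i) = +-monoʳ-< 4 (toℕ<n i)

  ρ-injective : Injective _≡_ _≡_ ρ
  ρ-injective {zero}  {zero}   _ = refl
  ρ-injective {suc i} {suc i′} e = cong suc (toℕ-injective (+-cancelˡ-≡ 4 _ _ e))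

  ρ≢d : ∀ i x → ρ i ≢ d x
  ρ≢d zero    zero             ()
  ρ≢d zero    (suc zero)       ()
  ρ≢d zero    (suc (suc zero)) ()
  ρ≢d (suc i) zero             ()
  ρ≢d (suc i) (suc zero)       ()
  ρ≢d (suc i) (suc (suc zero)) ()

  ρ-onto : ∀ k → k < n → (∀ x → k ≢ d x) → ∃ λ i → ρ i ≡ k
  ρ-onto 0 _ k∉d = ⊥-elim (k∉d zero refl)
  ρ-onto 1 _ k∉d = ⊥-elim (k∉d (suc zero) refl)
  ρ-onto 2 _ _   = zero , refl
  ρ-onto 3 _ k∉d = ⊥-elim (k∉d (suc (suc zero)) refl)
  ρ-onto (suc (suc (suc (suc k)))) (s≤s (s≤s (s≤s (s≤s k<2+p)))) _ =
    suc (fromℕ< k<2+p) , cong (4 +_) (toℕ-fromℕ< k<2+p)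

  A : Design (3 + p) n n
  A i j = shift (ρ i) j

  A⁻ : Design (3 + p) (5 + p) n
  A⁻ = dropFirstColumn A

  block : Fin n → Fin n → Bool
  block j = inImage (λ x → shift (d x) j)

  A-binary : Binary A
  A-binary = (λ i j j′ → shift-injective (<⇒≤ (ρ<n i)))
           , (λ j i i′ e → ρ-injective (shift-injectiveˡ j (ρ<n i) (ρ<n i′) e))

  rowHas-A : ∀ i s → rowHas A i s ≡ true
  rowHas-A i s = inImage-intro (A i) (unshift (ρ i) s) (shift-unshift (<⇒≤ (ρ<n i)) s)

  rowHas-A⁻ : ∀ i s → rowHas A⁻ i s ≡ not (does (A i zero ≟ s))
  rowHas-A⁻ i s = trans (rowHas-dropFirstColumn A A-binary i s) (cong (_∧ not (does (A i zero ≟ s))) (rowHas-A i s))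

  colHas-A : ∀ j s → colHas A j s ≡ not (block j s)
  colHas-A j s with block j s in s∈block
  ... | true  = let x , s≡ = inImage-elim (λ x → shift (d x) j) s∈block in
    inImage-false (λ i → A i j) λ i Aij≡s →
      ρ≢d i x (shift-injectiveˡ j (ρ<n i) (d<n x) (trans Aij≡s (sym s≡)))
  ... | false = let i , ρi≡k = ρ-onto k (toℕ<n t) k∉d in
    inImage-intro (λ i → A i j) i (trans (cong (λ k → shift k j) ρi≡k) shift-k≡s)
    where
    t = unshift (toℕ j) s
    k = toℕ t
    shift-k≡s : shift k j ≡ s
    shift-k≡s = trans (shift-comm t j) (shift-unshift (<⇒≤ (toℕ<n j)) s)
    k∉d : ∀ x → k ≢ d x
    k∉d x k≡dx = case trans (sym s∈block) (inImage-intro (λ x → shift (d x) j) x (trans (cong (λ k → shift k j) (sym k≡dx)) shift-k≡s)) of λ ()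

  count-block : ∀ j → count (block j) ≡ 3
  count-block j = count-inImage (λ x → shift (d x) j) λ {x} {y} e → d-injective (shift-injectiveˡ j (d<n x) (d<n y) e)

  A⁻-binary : Binary A⁻
  A⁻-binary = dropFirstColumn-binary A A-binary

  replication-A : ∀ s → FloorOrCeil (replication A s) ((3 + p) * n) n
  replication-A s = inj₁ (begin
    replication A s                ≡⟨ replication-of-binaryRows A (proj₁ A-binary) s ⟩
    count (λ i → rowHas A i s)     ≡⟨ count-cong (λ i → rowHas-A i s) ⟩
    count {3 + p} (λ _ → true)     ≡⟨ count-true ⟩
    3 + p                          ≡⟨ m*n/n≡m (3 + p) n ⟨
    (3 + p) * n / n                ∎)
    where open ≡-Reasoning

  replication-A⁻ : ∀ s → FloorOrCeil (replication A⁻ s) ((3 + p) * (5 + p)) n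
  replication-A⁻ s = floorOrCeil-of-bounds {N = n} (<⇒≤ lo) (<⇒≤ hi) (λ _ → hi) (λ _ → lo)
    (subst (_∈⟦ 2 + p , 3 + p ⟧) (sym replication≡) (count-not-∈ (λ i → does (A i zero ≟ s)) column₀-unique))
    where
    lo-identity : ∀ q → (6 + q) * (2 + q) + 3 ≡ (3 + q) * (5 + q)
    lo-identity = solve-∀
    hi-identity : ∀ q → (3 + q) * (5 + q) + (3 + q) ≡ (6 + q) * (3 + q)
    hi-identity = solve-∀
    lo : n * (2 + p) < (3 + p) * (5 + p)
    lo = subst (n * (2 + p) <_) (lo-identity p) (m<m+n (n * (2 + p)) (s≤s z≤n))
    hi : (3 + p) * (5 + p) < n * (3 + p)
    hi = subst ((3 + p) * (5 + p) <_) (hi-identity p) (m<m+n ((3 + p) * (5 + p)) (s≤s z≤n))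
    replication≡ : replication A⁻ s ≡ count (λ i → not (does (A i zero ≟ s)))
    replication≡ = trans (replication-of-binaryRows A⁻ (proj₁ A⁻-binary) s) (count-cong λ i → rowHas-A⁻ i s)
    column₀-unique : count (λ i → does (A i zero ≟ s)) ≤ 1
    column₀-unique = count-≤1 _ λ i i′ Ai0≡s Ai′0≡s →
      proj₂ A-binary zero i i′ (trans (does-true⇒ (A i zero ≟ s) Ai0≡s) (sym (does-true⇒ (A i′ zero ≟ s) Ai′0≡s)))

  rcMeet-A : ∀ i j → rcMeet A i j ∈⟦ 3 + p , 4 + p ⟧
  rcMeet-A i j = count-∧-of-complements {p = λ _ → false} {q = block j} (3 + p) (rowHas-A i) (colHas-A j)
    (cong₂ (λ k l → k + l + (3 + p)) (count-false {n}) (count-block j)) (≤-trans (≤-reflexive (count-false {n})) z≤n)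

  rrMeet-A : ∀ i i′ → rrMeet A i i′ ∈⟦ n , suc n ⟧
  rrMeet-A i i′ = count-∧-of-complements {p = λ _ → false} {q = λ _ → false} n (rowHas-A i) (rowHas-A i′)
    (cong₂ (λ k l → k + l + n) (count-false {n}) (count-false {n})) (≤-trans (≤-reflexive (count-false {n})) z≤n)

  removedSymbol-meet≤1 : ∀ i (q : Fin n → Bool) → count (λ s → does (A i zero ≟ s) ∧ q s) ≤ 1
  removedSymbol-meet≤1 i q = ≤-trans (count-∧-≤ˡ (λ s → does (A i zero ≟ s)) q) (≤-reflexive (count-≟ (A i zero)))

  rcMeet-A⁻ : ∀ i j → rcMeet A⁻ i j ∈⟦ 2 + p , 3 + p ⟧
  rcMeet-A⁻ i j = count-∧-of-complements (2 + p) (rowHas-A⁻ i) (colHas-A (suc j))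
    (cong₂ (λ k l → k + l + (2 + p)) (count-≟ (A i zero)) (count-block (suc j))) (removedSymbol-meet≤1 i (block (suc j)))

  rrMeet-A⁻ : ∀ i i′ → rrMeet A⁻ i i′ ∈⟦ 4 + p , 5 + p ⟧
  rrMeet-A⁻ i i′ = count-∧-of-complements (4 + p) (rowHas-A⁻ i) (rowHas-A⁻ i′)
    (cong₂ (λ k l → k + l + (4 + p)) (count-≟ (A i zero)) (count-≟ (A i′ zero))) (removedSymbol-meet≤1 i (λ s → does (A i′ zero ≟ s)))

  blocks-meet≤1 : 7 ≤ n → ∀ j j′ → j ≢ j′ → count (λ s → block j s ∧ block j′ s) ≤ 1
  blocks-meet≤1 7≤n j j′ j≢j′ = count-≤1 _ λ s s′ s∈both s′∈both →
    let x  , xj≡s    = inImage-elim (λ x → shift (d x) j)  (∧-conicalˡ _ _ s∈both)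
        y  , yj′≡s   = inImage-elim (λ x → shift (d x) j′) (∧-conicalʳ _ _ s∈both)
        x′ , x′j≡s′  = inImage-elim (λ x → shift (d x) j)  (∧-conicalˡ _ _ s′∈both)
        y′ , y′j′≡s′ = inImage-elim (λ x → shift (d x) j′) (∧-conicalʳ _ _ s′∈both)
    in trans (sym xj≡s) (trans (sidon-unique {x} {y} {x′} {y′} (trans xj≡s (sym yj′≡s)) (trans x′j≡s′ (sym y′j′≡s′))) x′j≡s′)
    where
    sum<n : ∀ x y → d x + d y < n
    sum<n x y = <-≤-trans (s≤s (+-mono-≤ (d≤3 x) (d≤3 y))) 7≤n
    sidon-unique : ∀ {x y x′ y′} → shift (d x) j ≡ shift (d y) j′ → shift (d x′) j ≡ shift (d y′) j′ →
                   shift (d x) j ≡ shift (d x′) j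
    sidon-unique {x} {y} {x′} {y′} e e′
      with d-sidon x y x′ y′ (shift-injectiveˡ j (sum<n x y′) (sum<n x′ y) (shift-parallelogram {d x} {d y} {d x′} {d y′} {j} {j′} e e′))
    ... | inj₁ refl = refl
    ... | inj₂ refl = ⊥-elim (j≢j′ (shift-injective (<⇒≤ (d<n x)) e))

  ccMeet-A : 7 ≤ n → ∀ j j′ → j ≢ j′ → ccMeet A j j′ ∈⟦ p , suc p ⟧
  ccMeet-A 7≤n j j′ j≢j′ = count-∧-of-complements p (colHas-A j) (colHas-A j′)
    (cong₂ (λ k l → k + l + p) (count-block j) (count-block j′)) (blocks-meet≤1 7≤n j j′ j≢j′)

  nearTripleArrays : ∀ {a} → (∀ j j′ → j ≢ j′ → ccMeet A j j′ ∈⟦ a , suc a ⟧) →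
                     NearTripleArray (3 + p) n n × NearTripleArray (3 + p) (5 + p) n
  nearTripleArrays ccMeet∈ =
      (A  , isNearTripleArray A A-binary replication-A rcMeet-A (λ i i′ _ → rrMeet-A i i′) ccMeet∈)
    , (A⁻ , isNearTripleArray A⁻ A⁻-binary replication-A⁻ rcMeet-A⁻ (λ i i′ _ → rrMeet-A⁻ i i′)
              (λ j j′ j≢j′ → ccMeet∈ (suc j) (suc j′) (j≢j′ ∘ suc-injective)))

-- Modulo 6, D is not a Sidon set (3 ≡ −3), and the column meets take the values 1 and 2.
ccMeet-A₆ : ∀ j j′ → j ≢ j′ → ccMeet (Construction.A 0) j j′ ∈⟦ 1 , 2 ⟧
ccMeet-A₆ = toWitness {a? = all? λ j → all? λ j′ → ¬? (j ≟ j′) →-dec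
  (1 ≤? ccMeet (Construction.A 0) j j′ ×-dec ccMeet (Construction.A 0) j j′ ≤? 2)} _

corollary5p11 : (n : ℕ) → 6 ≤ n →
    NearTripleArray (n ∸ 3) n n × NearTripleArray (n ∸ 3) (n ∸ 1) n
corollary5p11 n 6≤n with m≤n⇒∃[o]m+o≡n 6≤n
... | 0     , refl = Construction.nearTripleArrays 0 ccMeet-A₆
... | suc q , refl = Construction.nearTripleArrays (suc q) (Construction.ccMeet-A (suc q) (+-monoʳ-≤ 6 (s≤s z≤n)))
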